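{- Let $O=(0,0,0)$ and let $P,Q\in\mathbb{Z}^3$ be such that the triangle $OPQ$ is equilateral (and non-degenerate), and let $l=|OP|$. Then there exist integers $a,b,c,d$ with $a^2+b^2+c^2=3d^2$ and $l^2=2d$ such that both $P$ and $Q$ lie in the plane $\{(\alpha,\beta,\gamma)\in\mathbb{R}^3 : a\alpha+b\beta+c\gamma=0\}$. -}

module Defs where

open import Data.Integer using (ℤ; _+_; _-_; _*_; 0ℤ)
open import Data.Product using (_×_; _,_)
open import Relation.Binary.PropositionalEquality using (_≡_)
open import Relation.Nullary using (¬_)

ℤ³ : Set
ℤ³ = ℤ × ℤ × ℤ

O : ℤ³
O = 0ℤ , 0ℤ , 0ℤ

sqDist : ℤ³ → ℤ³ → ℤ
sqDist (x₁ , x₂ , x₃) (y₁ , y₂ , y₃) =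
  (x₁ - y₁) * (x₁ - y₁) + (x₂ - y₂) * (x₂ - y₂) + (x₃ - y₃) * (x₃ - y₃)

-- Triangle XYZ is equilateral and non-degenerate:
-- |XY| = |YZ| = |ZX| and X ≠ Y (hence all side lengths are positive).
record Equilateral (X Y Z : ℤ³) : Set where
  field
    XY≡YZ : sqDist X Y ≡ sqDist Y Z
    YZ≡ZX : sqDist Y Z ≡ sqDist Z X
    X≢Y   : ¬ (X ≡ Y)

InPlane : ℤ → ℤ → ℤ → ℤ³ → Set
InPlane a b c (α , β , γ) = a * α + b * β + c * γ ≡ 0ℤ

{-# OPTIONS --safe #-}
module Submission where

-- If OPQ is equilateral then |P|² = |Q|² = |P − Q|², so polarisation gives
-- |P|² = 2 (P · Q) =: 2d.  The cross product P ⨯ Q is an integer normal of the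
-- plane OPQ, and by Lagrange's identity its squared length is
-- |P|² |Q|² − (P · Q)² = 4d² − d² = 3d².

open import Algebra.Bundles.Raw using (RawRing)
open import Data.Product using (∃; _×_; _,_; proj₁; proj₂)
open import Level using (Level)

module Vector3 {c ℓ : Level} (R : RawRing c ℓ) where
  open RawRing R

  infixl 9 _·_
  infixl 10 _⊖_ _⨯_

  Vec3 : Set c
  Vec3 = Carrier × Carrier × Carrier

  𝟎 : Vec3
  𝟎 = 0# , 0# , 0#

  _⊖_ : Vec3 → Vec3 → Vec3
  (x₁ , x₂ , x₃) ⊖ (y₁ , y₂ , y₃) = x₁ + - y₁ , x₂ + - y₂ , x₃ + - y₃

  _·_ : Vec3 → Vec3 → Carrier
  (x₁ , x₂ , x₃) · (y₁ , y₂ , y₃) = x₁ * y₁ + x₂ * y₂ + x₃ * y₃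

  _⨯_ : Vec3 → Vec3 → Vec3
  (x₁ , x₂ , x₃) ⨯ (y₁ , y₂ , y₃) =
    x₂ * y₃ + - (x₃ * y₂) , x₃ * y₁ + - (x₁ * y₃) , x₁ * y₂ + - (x₂ * y₁)

open import Defs
open import Data.Integer using (ℤ; _+_; _*_; +_; 0ℤ; 1ℤ)
open import Data.Integer.Base using (+-*-rawRing)
open import Data.Integer.Properties using (+-0-abelianGroup)
open import Algebra.Properties.AbelianGroup +-0-abelianGroup using (∙-cancelˡ; ∙-cancelʳ)
open import Data.Integer.Solver using (module +-*-Solver)
open import Data.Nat using (ℕ)
open import Relation.Binary.PropositionalEquality
  using (_≡_; refl; sym; trans; cong; cong₂; module ≡-Reasoning)

open Vector3 +-*-rawRing
open +-*-Solver using (Polynomial; con; _:+_; _:*_; :-_; _:=_; solve)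

polynomialRawRing : ℕ → RawRing _ _
polynomialRawRing n = record
  { Carrier = Polynomial n
  ; _≈_     = _≡_
  ; _+_     = _:+_
  ; _*_     = _:*_
  ; -_      = :-_
  ; 0#      = con 0ℤ
  ; 1#      = con 1ℤ
  }

-- Each vector identity over ℤ is proved by restating it over polynomials and
-- normalising: evaluating the symbolic operations gives the integer ones on the
-- nose, and so does sqDist X Y = (X ⊖ Y) · (X ⊖ Y), since i - j = i + - j in ℤ.
open module Symbolic {n : ℕ} = Vector3 (polynomialRawRing n)
  using () renaming (𝟎 to :𝟎; _⊖_ to _:⊖_; _·_ to _:·_; _⨯_ to _:⨯_)

sqDist-originˡ : ∀ X → sqDist O X ≡ X · X
sqDist-originˡ (x₁ , x₂ , x₃) =
  solve 3 (λ x₁ x₂ x₃ → let X = x₁ , x₂ , x₃ in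
    (:𝟎 :⊖ X) :· (:𝟎 :⊖ X) := X :· X) refl x₁ x₂ x₃

sqDist-originʳ : ∀ X → sqDist X O ≡ X · X
sqDist-originʳ (x₁ , x₂ , x₃) =
  solve 3 (λ x₁ x₂ x₃ → let X = x₁ , x₂ , x₃ in
    (X :⊖ :𝟎) :· (X :⊖ :𝟎) := X :· X) refl x₁ x₂ x₃

sqDist-polarisation : ∀ X Y → sqDist X Y + + 2 * (X · Y) ≡ X · X + Y · Y
sqDist-polarisation (x₁ , x₂ , x₃) (y₁ , y₂ , y₃) =
  solve 6 (λ x₁ x₂ x₃ y₁ y₂ y₃ → let X = x₁ , x₂ , x₃ ; Y = y₁ , y₂ , y₃ in
    (X :⊖ Y) :· (X :⊖ Y) :+ con (+ 2) :* (X :· Y) := X :· X :+ Y :· Y)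
    refl x₁ x₂ x₃ y₁ y₂ y₃

⨯-orthogonalˡ : ∀ X Y → X ⨯ Y · X ≡ 0ℤ
⨯-orthogonalˡ (x₁ , x₂ , x₃) (y₁ , y₂ , y₃) =
  solve 6 (λ x₁ x₂ x₃ y₁ y₂ y₃ → let X = x₁ , x₂ , x₃ ; Y = y₁ , y₂ , y₃ in
    X :⨯ Y :· X := con 0ℤ) refl x₁ x₂ x₃ y₁ y₂ y₃

⨯-orthogonalʳ : ∀ X Y → X ⨯ Y · Y ≡ 0ℤ
⨯-orthogonalʳ (x₁ , x₂ , x₃) (y₁ , y₂ , y₃) =
  solve 6 (λ x₁ x₂ x₃ y₁ y₂ y₃ → let X = x₁ , x₂ , x₃ ; Y = y₁ , y₂ , y₃ in
    X :⨯ Y :· Y := con 0ℤ) refl x₁ x₂ x₃ y₁ y₂ y₃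

lagrange-identity : ∀ X Y → X ⨯ Y · X ⨯ Y + (X · Y) * (X · Y) ≡ (X · X) * (Y · Y)
lagrange-identity (x₁ , x₂ , x₃) (y₁ , y₂ , y₃) =
  solve 6 (λ x₁ x₂ x₃ y₁ y₂ y₃ → let X = x₁ , x₂ , x₃ ; Y = y₁ , y₂ , y₃ in
    X :⨯ Y :· X :⨯ Y :+ (X :· Y) :* (X :· Y) := (X :· X) :* (Y :· Y))
    refl x₁ x₂ x₃ y₁ y₂ y₃

module _ {P Q : ℤ³} (equilateral : Equilateral O P Q) where
  open Equilateral equilateral
  open ≡-Reasoning

  equilateral⇒Q·Q≡P·P : Q · Q ≡ P · P
  equilateral⇒Q·Q≡P·P = begin
    Q · Q        ≡⟨ sym (sqDist-originʳ Q) ⟩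
    sqDist Q O   ≡⟨ sym (trans XY≡YZ YZ≡ZX) ⟩
    sqDist O P   ≡⟨ sqDist-originˡ P ⟩
    P · P        ∎

  equilateral⇒P·P≡2P·Q : P · P ≡ + 2 * (P · Q)
  equilateral⇒P·P≡2P·Q = sym (∙-cancelˡ (P · P) _ _ (begin
    P · P + + 2 * (P · Q)       ≡⟨ cong (λ z → z + + 2 * (P · Q))
                                        (trans (sym (sqDist-originˡ P)) XY≡YZ) ⟩
    sqDist P Q + + 2 * (P · Q)  ≡⟨ sqDist-polarisation P Q ⟩
    P · P + Q · Q               ≡⟨ cong (λ z → P · P + z) equilateral⇒Q·Q≡P·P ⟩
    P · P + P · P               ∎))

  equilateral⇒|P⨯Q|²≡3[P·Q]² : P ⨯ Q · P ⨯ Q ≡ + 3 * ((P · Q) * (P · Q))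
  equilateral⇒|P⨯Q|²≡3[P·Q]² = ∙-cancelʳ (d * d) _ _ (begin
    P ⨯ Q · P ⨯ Q + d * d   ≡⟨ lagrange-identity P Q ⟩
    (P · P) * (Q · Q)       ≡⟨ cong₂ _*_ equilateral⇒P·P≡2P·Q
                                          (trans equilateral⇒Q·Q≡P·P equilateral⇒P·P≡2P·Q) ⟩
    + 2 * d * (+ 2 * d)     ≡⟨ solve 1 (λ d → con (+ 2) :* d :* (con (+ 2) :* d)
                                          := con (+ 3) :* (d :* d) :+ d :* d) refl d ⟩
    + 3 * (d * d) + d * d   ∎)
    where
    d : ℤ
    d = P · Q

proposition2p1 : (P Q : ℤ³) → Equilateral O P Q →
    ∃ λ (a : ℤ) → ∃ λ (b : ℤ) → ∃ λ (c : ℤ) → ∃ λ (d : ℤ) →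
      (a * a + b * b + c * c ≡ + 3 * (d * d))
      × (sqDist O P ≡ + 2 * d)
      × InPlane a b c P
      × InPlane a b c Q
proposition2p1 P Q equilateral =
  proj₁ N , proj₁ (proj₂ N) , proj₂ (proj₂ N) , P · Q ,
  equilateral⇒|P⨯Q|²≡3[P·Q]² equilateral ,
  trans (sqDist-originˡ P) (equilateral⇒P·P≡2P·Q equilateral) ,
  ⨯-orthogonalˡ P Q ,
  ⨯-orthogonalʳ P Q
  where
  N : ℤ³
  N = P ⨯ Q
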